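{- Let $k$ be a positive integer and consider a red-blue colouring of $\mathbb{Z}$ that contains no $(2,k)$-AP. Suppose $[0,d]$ is a gap. Then for every positive integer $n$, each of the sets $d[n, (k+1)n] = \{dj : n \le j \le (k+1)n\}$ and $d[-(k+1)n, -n] = \{dj : -(k+1)n \le j \le -n\}$ (with $j$ ranging over integers) contains a red element.
   Context: A $(2,k)$-AP in a red-blue colouring of $\mathbb{Z}$ is an arithmetic progression $x, x+e, \dots, x+(k+1)e$ of length $k+2$ with common difference $e \neq 0$ (possibly negative) whose first two elements are red and whose last $k$ elements are blue. "$[0,d]$ is a gap" means $d \ge 1$, $0$ and $d$ are red, and $1, \dots, d-1$ are blue. -}

module Defs where

open import Data.Nat using (ℕ; suc; _<_)
open import Data.Integer using (ℤ; +_; _+_; _*_; -_; _≤_)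
open import Data.Product using (Σ; _×_; ∃)
open import Relation.Binary.PropositionalEquality using (_≡_; _≢_)

data Colour : Set where
  red blue : Colour

Colouring : Set
Colouring = ℤ → Colour

Is2kAP : (k : ℕ) → Colouring → ℤ → ℤ → Set
Is2kAP k c x e =
  (e ≢ + 0)
  × (c x ≡ red)
  × (c (x + e) ≡ red)
  × ((i : ℕ) → 2 Data.Nat.≤ i → i Data.Nat.≤ suc k → c (x + (+ i) * e) ≡ blue)

No2kAP : ℕ → Colouring → Set
No2kAP k c = (x e : ℤ) → Is2kAP k c x e → Data.Empty.⊥
  where import Data.Empty

IsGap : Colouring → ℤ → Set
IsGap c d =
  (+ 1 ≤ d)
  × (c (+ 0) ≡ red)
  × (c d ≡ red)
  × ((t : ℤ) → + 1 ≤ t → t Data.Integer.< d → c t ≡ blue)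

-- If 0 and mg are red (g = ±d, m ≥ 1), the progression 0, mg, 2mg, …, (k+1)mg is
-- not a (2,k)-AP, so some img with 2 ≤ i ≤ k+1 is red.  Iterating from m < n, the
-- index grows strictly, and as it is below n before each step it never exceeds
-- (k+1)n; so it lands in [n, (k+1)n].  For g = d start at m = 1; for g = -d the
-- progression d, 0, -d, …, -kd supplies a red start m ∈ [1, k].
module Submission where

open import Defs
open import Data.Nat using (ℕ; suc)
open import Data.Integer using (ℤ; +_; _*_; -_; _≤_)
open import Data.Product using (Σ; _×_)
open import Relation.Binary.PropositionalEquality using (_≡_)

open import Data.Nat as ℕ using (zero; z≤n; s≤s; _<_; _≤?_; >-nonZero)
open import Data.Nat.Properties as ℕ
  using ( ≤-refl; ≤-trans; <⇒≤; m≤n⇒m≤1+n; m<n⇒m<1+n; m<1+n⇒m<n∨m≡n; m<1+n⇒m≤n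
        ; m<m*n; m≤m*n; m≤n+m; *-mono-≤; +-suc; +-monoˡ-≤; +-identityʳ)
open import Data.Integer as ℤ using (+≤+)
open import Data.Integer.Properties as ℤ
  using (*-comm; *-assoc; *-identityˡ; +-identityˡ; +-inverseʳ; pos-*; neg-mono-≤; i*j≡0⇒i≡0∨j≡0; neg-injective)
open import Data.Integer.Tactic.RingSolver using (solve-∀)
open import Data.Product using (∃; _,_)
open import Data.Sum using (_⊎_; inj₁; inj₂; [_,_]′)
open import Data.Empty using (⊥-elim)
open import Relation.Nullary using (yes; no; contradiction)
open import Relation.Binary.PropositionalEquality using (_≢_; refl; sym; subst; cong; module ≡-Reasoning)

red-or-all-blue : (g : ℕ → Colour) (a b : ℕ) →
  (∃ λ i → a ℕ.≤ i × i < b × g i ≡ red) ⊎ (∀ i → a ℕ.≤ i → i < b → g i ≡ blue)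
red-or-all-blue g a zero = inj₂ λ _ _ ()
red-or-all-blue g a (suc b) with g b in gb | a ≤? b | red-or-all-blue g a b
... | red  | yes a≤b | _ = inj₁ (b , a≤b , ≤-refl , gb)
... | _    | _       | inj₁ (i , a≤i , i<b , gi) = inj₁ (i , a≤i , m<n⇒m<1+n i<b , gi)
... | red  | no a≰b  | inj₂ _ =
  inj₂ λ i a≤i i<1+b → contradiction (≤-trans a≤i (m<1+n⇒m≤n i<1+b)) a≰b
... | blue | _       | inj₂ blueBelow =
  inj₂ λ i a≤i i<1+b → [ blueBelow i a≤i , (λ { refl → gb }) ]′ (m<1+n⇒m<n∨m≡n i<1+b)

climb-into-range : (P : ℕ → Set) (b : ℕ) →
  (∀ m → 1 ℕ.≤ m → P m → ∃ λ i → 2 ℕ.≤ i × i ℕ.≤ b × P (i ℕ.* m)) →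
  ∀ n m → 1 ℕ.≤ m → m ℕ.≤ b ℕ.* n → P m → ∃ λ j → n ℕ.≤ j × j ℕ.≤ b ℕ.* n × P j
climb-into-range P b step n m = climb n m (m≤n+m n m)
  where
  climb : ∀ fuel m → n ℕ.≤ m ℕ.+ fuel → 1 ℕ.≤ m → m ℕ.≤ b ℕ.* n → P m →
    ∃ λ j → n ℕ.≤ j × j ℕ.≤ b ℕ.* n × P j
  climb fuel m n≤m+fuel 1≤m m≤bn Pm with n ≤? m
  ... | yes n≤m = m , n≤m , m≤bn , Pm
  climb zero m n≤m+0 _ _ _ | no n≰m = contradiction (subst (n ℕ.≤_) (+-identityʳ m) n≤m+0) n≰m
  climb (suc fuel) m n≤m+1+fuel 1≤m _ Pm | no n≰m with step m 1≤m Pm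
  ... | i , 2≤i , i≤b , Pim = climb fuel (i ℕ.* m) n≤im+fuel (≤-trans 1≤m (<⇒≤ m<im)) im≤bn Pim
    where
    m<im : m < i ℕ.* m
    m<im = subst (m <_) (ℕ.*-comm m i) (m<m*n m i {{>-nonZero 1≤m}} 2≤i)
    n≤im+fuel : n ℕ.≤ i ℕ.* m ℕ.+ fuel
    n≤im+fuel = ≤-trans n≤m+1+fuel
      (subst (ℕ._≤ i ℕ.* m ℕ.+ fuel) (sym (+-suc m fuel)) (+-monoˡ-≤ fuel m<im))
    im≤bn : i ℕ.* m ℕ.≤ b ℕ.* n
    im≤bn = *-mono-≤ i≤b (<⇒≤ (ℕ.≰⇒> n≰m))

neg-≢0 : ∀ {d} → d ≢ + 0 → - d ≢ + 0
neg-≢0 d≢0 -d≡0 = d≢0 (neg-injective -d≡0)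

module _ {k : ℕ} {c : Colouring} (noAP : No2kAP k c) where

  no2kAP⇒red-term : ∀ {x e} → e ≢ + 0 → c x ≡ red → c (x ℤ.+ e) ≡ red →
    ∃ λ i → 2 ℕ.≤ i × i ℕ.≤ suc k × c (x ℤ.+ + i * e) ≡ red
  no2kAP⇒red-term {x} {e} e≢0 cx cx+e with red-or-all-blue (λ i → c (x ℤ.+ + i * e)) 2 (2 ℕ.+ k)
  ... | inj₁ (i , 2≤i , s≤s i≤1+k , ci) = i , 2≤i , i≤1+k , ci
  ... | inj₂ allBlue =
    ⊥-elim (noAP x e (e≢0 , cx , cx+e , λ i 2≤i i≤1+k → allBlue i 2≤i (s≤s i≤1+k)))

  module _ (c0 : c (+ 0) ≡ red) where

    red-multiple-step : ∀ {g} → g ≢ + 0 → ∀ m → 1 ℕ.≤ m → c (+ m * g) ≡ red →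
      ∃ λ i → 2 ℕ.≤ i × i ℕ.≤ suc k × c (+ (i ℕ.* m) * g) ≡ red
    red-multiple-step {g} g≢0 m@(suc _) _ cmg
      with no2kAP⇒red-term mg≢0 c0 (subst (λ z → c z ≡ red) (sym (+-identityˡ (+ m * g))) cmg)
      where
      mg≢0 : + m * g ≢ + 0
      mg≢0 mg≡0 = [ (λ ()) , g≢0 ]′ (i*j≡0⇒i≡0∨j≡0 (+ m) mg≡0)
    ... | i , 2≤i , i≤1+k , ci = i , 2≤i , i≤1+k , subst (λ z → c z ≡ red) 0+i*mg≡im*g ci
      where
      open ≡-Reasoning
      0+i*mg≡im*g : + 0 ℤ.+ + i * (+ m * g) ≡ + (i ℕ.* m) * g
      0+i*mg≡im*g = begin
        + 0 ℤ.+ + i * (+ m * g) ≡⟨ +-identityˡ _ ⟩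
        + i * (+ m * g)         ≡⟨ sym (*-assoc (+ i) (+ m) g) ⟩
        + i * + m * g           ≡⟨ cong (_* g) (sym (pos-* i m)) ⟩
        + (i ℕ.* m) * g         ∎

    red-multiple-in-range : ∀ {g} → g ≢ + 0 → ∀ n m → 1 ℕ.≤ m → m ℕ.≤ suc k ℕ.* n →
      c (+ m * g) ≡ red → ∃ λ j → n ℕ.≤ j × j ℕ.≤ suc k ℕ.* n × c (+ j * g) ≡ red
    red-multiple-in-range {g} g≢0 =
      climb-into-range (λ j → c (+ j * g) ≡ red) (suc k) (red-multiple-step g≢0)

    red-negative-multiple : ∀ {d} → d ≢ + 0 → c d ≡ red →
      ∃ λ j → 1 ℕ.≤ j × j ℕ.≤ k × c (+ j * - d) ≡ red
    red-negative-multiple {d} d≢0 cd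
      with no2kAP⇒red-term (neg-≢0 d≢0) cd (subst (λ z → c z ≡ red) (sym (+-inverseʳ d)) c0)
    ... | suc j , s≤s 1≤j , s≤s j≤k , ci =
      j , 1≤j , j≤k , subst (λ z → c z ≡ red) (d+[1+j]*-d≡j*-d d (+ j)) ci
      where
      d+[1+j]*-d≡j*-d : ∀ d J → d ℤ.+ (+ 1 ℤ.+ J) * - d ≡ J * - d
      d+[1+j]*-d≡j*-d = solve-∀

lemma5 : (k : ℕ) → 1 Data.Nat.≤ k → (c : Colouring) → No2kAP k c →
    (d : ℤ) → IsGap c d → (n : ℕ) → 1 Data.Nat.≤ n →
    (Σ ℤ λ j → (+ n ≤ j) × (j ≤ + (suc k Data.Nat.* n)) × (c (d * j) ≡ red))
    × (Σ ℤ λ j → (- (+ (suc k Data.Nat.* n)) ≤ j) × (j ≤ - (+ n)) × (c (d * j) ≡ red))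
lemma5 k _ c noAP d (+≤+ (s≤s _) , c0 , cd , _) n 1≤n = positive , negative
  where
  d≢0 : d ≢ + 0
  d≢0 ()
  1+k≤[1+k]n : suc k ℕ.≤ suc k ℕ.* n
  1+k≤[1+k]n = m≤m*n (suc k) n {{>-nonZero 1≤n}}
  positive : Σ ℤ λ j → (+ n ≤ j) × (j ≤ + (suc k ℕ.* n)) × (c (d * j) ≡ red)
  positive with red-multiple-in-range noAP c0 d≢0 n 1 ≤-refl (≤-trans (s≤s z≤n) 1+k≤[1+k]n)
                  (subst (λ z → c z ≡ red) (sym (*-identityˡ d)) cd)
  ... | j , n≤j , j≤[1+k]n , c[jd] =
    + j , +≤+ n≤j , +≤+ j≤[1+k]n , subst (λ z → c z ≡ red) (*-comm (+ j) d) c[jd]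
  negative : Σ ℤ λ j → (- (+ (suc k ℕ.* n)) ≤ j) × (j ≤ - (+ n)) × (c (d * j) ≡ red)
  negative with red-negative-multiple noAP c0 d≢0 cd
  ... | m , 1≤m , m≤k , c[-md]
    with red-multiple-in-range noAP c0 (neg-≢0 d≢0) n m 1≤m (≤-trans (m≤n⇒m≤1+n m≤k) 1+k≤[1+k]n) c[-md]
  ... | j , n≤j , j≤[1+k]n , c[-jd] =
    - + j , neg-mono-≤ (+≤+ j≤[1+k]n) , neg-mono-≤ (+≤+ n≤j) ,
    subst (λ z → c z ≡ red) (j*-d≡d*-j (+ j) d) c[-jd]
    where
    j*-d≡d*-j : ∀ J d → J * - d ≡ d * - J
    j*-d≡d*-j = solve-∀
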